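{- Let $F_1$ be a formula of the propositional provability calculus that does not preserve the unary relation $\{\mathbb{0},\rho\}$ on $\mathfrak{B}_2$. Then some formula $A(p)$ in one variable with $A[\mathbb{0}]\in\{\sigma,\mathbb{1}\}$ is expressible in $L\mathfrak{B}_2$ via $F_1$.
   Context: Formulas of the propositional provability calculus are built from propositional variables using $\&,\vee,\supset,\neg$ and the unary modal connective $\Delta$. The algebra $\mathfrak{B}_2=(\{\mathbb{0},\rho,\sigma,\mathbb{1}\};\&,\vee,\supset,\neg,\Delta)$ is the four-element Boolean algebra with least element $\mathbb{0}$, greatest element $\mathbb{1}$ and atoms $\rho,\sigma$ (so $\neg\rho=\sigma$), with usual Boolean operations and $\Delta\mathbb{0}=\Delta\rho=\sigma$, $\Delta\sigma=\Delta\mathbb{1}=\mathbb{1}$. $F[\alpha_1,\dots,\alpha_n]$ is the value of $F(p_1,\dots,p_n)$ on $\mathfrak{B}_2$ when $p_i$ takes value $\alpha_i$. $L\mathfrak{B}_2$ is the set of formulas taking value $\mathbb{1}$ under every evaluation on $\mathfrak{B}_2$; $A,B$ are equivalent in $L\mathfrak{B}_2$ if $(A\supset B)\&(B\supset A)\in L\mathfrak{B}_2$. A formula $F(p_1,\dots,p_n)$ preserves a unary relation $S\subseteq\mathfrak{B}_2$ if $\alpha_1,\dots,\alpha_n\in S$ implies $F[\alpha_1,\dots,\alpha_n]\in S$. A formula is expressible via a set of formulas $\Sigma$ in $L\mathfrak{B}_2$ if it belongs to the smallest set of formulas containing all propositional variables and all formulas of $\Sigma$ and closed under weak substitution (from $A$,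 $B$ obtain $A[p/B]$, the result of substituting $B$ for a variable $p$ in $A$) and under replacement by formulas equivalent in $L\mathfrak{B}_2$. -}

module Defs where

open import Data.Nat using (ℕ; _≟_)
open import Data.Product using (_×_; ∃)
open import Data.Sum using (_⊎_)
open import Relation.Nullary using (¬_; yes; no)
open import Relation.Binary.PropositionalEquality using (_≡_)

data Formula : Set where
  var : ℕ → Formula
  _&_ : Formula → Formula → Formula
  _∨_ : Formula → Formula → Formula
  _⊃_ : Formula → Formula → Formula
  ¬f_ : Formula → Formula
  Δ_  : Formula → Formula

data B2 : Set where
  𝟘 ρ σ 𝟙 : B2

neg : B2 → B2
neg 𝟘 = 𝟙
neg ρ = σ
neg σ = ρ
neg 𝟙 = 𝟘

and : B2 → B2 → B2
and 𝟘 y = 𝟘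
and 𝟙 y = y
and ρ 𝟘 = 𝟘
and ρ ρ = ρ
and ρ σ = 𝟘
and ρ 𝟙 = ρ
and σ 𝟘 = 𝟘
and σ ρ = 𝟘
and σ σ = σ
and σ 𝟙 = σ

or : B2 → B2 → B2
or x y = neg (and (neg x) (neg y))

imp : B2 → B2 → B2
imp x y = or (neg x) y

delta : B2 → B2
delta 𝟘 = σ
delta ρ = σ
delta σ = 𝟙
delta 𝟙 = 𝟙

eval : (ℕ → B2) → Formula → B2
eval v (var i) = v i
eval v (A & B) = and (eval v A) (eval v B)
eval v (A ∨ B) = or (eval v A) (eval v B)
eval v (A ⊃ B) = imp (eval v A) (eval v B)
eval v (¬f A)  = neg (eval v A)
eval v (Δ A)   = delta (eval v A)

Valid : Formula → Set
Valid A = ∀ (v : ℕ → B2) → eval v A ≡ 𝟙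

Equiv : Formula → Formula → Set
Equiv A B = Valid ((A ⊃ B) & (B ⊃ A))

subst : Formula → ℕ → Formula → Formula
subst (var i) p B with i ≟ p
... | yes _ = B
... | no _  = var i
subst (A₁ & A₂) p B = subst A₁ p B & subst A₂ p B
subst (A₁ ∨ A₂) p B = subst A₁ p B ∨ subst A₂ p B
subst (A₁ ⊃ A₂) p B = subst A₁ p B ⊃ subst A₂ p B
subst (¬f A) p B = ¬f subst A p B
subst (Δ A) p B = Δ subst A p B

data Expressible (Σ : Formula → Set) : Formula → Set where
  ex-var   : ∀ i → Expressible Σ (var i)
  ex-base  : ∀ {A} → Σ A → Expressible Σ A
  ex-subst : ∀ {A B} p → Expressible Σ A → Expressible Σ B → Expressible Σ (subst A p B)
  ex-equiv : ∀ {A B} → Expressible Σ A → Equiv A B → Expressible Σ B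

In0ρ : B2 → Set
In0ρ x = (x ≡ 𝟘) ⊎ (x ≡ ρ)

Preserves : Formula → (B2 → Set) → Set
Preserves F S = ∀ (v : ℕ → B2) → (∀ i → S (v i)) → S (eval v F)

data OnlyVar (p : ℕ) : Formula → Set where
  ov-var : OnlyVar p (var p)
  ov-&   : ∀ {A B} → OnlyVar p A → OnlyVar p B → OnlyVar p (A & B)
  ov-∨   : ∀ {A B} → OnlyVar p A → OnlyVar p B → OnlyVar p (A ∨ B)
  ov-⊃   : ∀ {A B} → OnlyVar p A → OnlyVar p B → OnlyVar p (A ⊃ B)
  ov-¬   : ∀ {A} → OnlyVar p A → OnlyVar p (¬f A)
  ov-Δ   : ∀ {A} → OnlyVar p A → OnlyVar p (Δ A)

-- 𝔅₂ is the Boolean algebra 𝟚 × 𝟚 with ρ = (1,0) and σ = (0,1). The σ-coordinate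
-- is a Boolean homomorphism sending every value of Δ to 1, so the σ-coordinate of
-- F[α₁,…,αₙ] depends only on the σ-coordinates of the αᵢ. As {𝟘, ρ} is exactly the
-- set where that coordinate is 0, F preserves {𝟘, ρ} as soon as F[𝟘,…,𝟘] ∈ {𝟘, ρ};
-- hence F₁[𝟘,…,𝟘] ∈ {σ, 𝟙}. Substituting one fresh variable p for all variables of
-- F₁, one at a time, expresses A(p) = F₁(p,…,p), and A[𝟘] = F₁[𝟘,…,𝟘].
module Submission where

open import Defs
open import Data.Nat using (ℕ; zero; suc; _≟_; _≤_; _<_; _⊔_; s≤s)
open import Data.Nat.Properties using (m≤m⊔n; m≤n⊔m; ≤-trans; ≤-refl; <⇒≤; ≤∧≢⇒<; 1+n≰n)
open import Data.Bool using (Bool; true; false; _∧_; not)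
open import Data.Product using (_×_; ∃₂; _,_)
open import Data.Sum using (_⊎_; inj₁; inj₂)
open import Relation.Nullary using (¬_; yes; no; contradiction)
open import Relation.Binary.PropositionalEquality using (_≡_; refl; sym; trans; cong; cong₂)

σ-part : B2 → Bool
σ-part 𝟘 = false
σ-part ρ = false
σ-part σ = true
σ-part 𝟙 = true

infix 4 _∼_

_∼_ : B2 → B2 → Set
x ∼ y = σ-part x ≡ σ-part y

σ-part-neg : ∀ x → σ-part (neg x) ≡ not (σ-part x)
σ-part-neg 𝟘 = refl
σ-part-neg ρ = refl
σ-part-neg σ = refl
σ-part-neg 𝟙 = refl

σ-part-and : ∀ x y → σ-part (and x y) ≡ σ-part x ∧ σ-part y
σ-part-and 𝟘 y = refl
σ-part-and ρ 𝟘 = refl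
σ-part-and ρ ρ = refl
σ-part-and ρ σ = refl
σ-part-and ρ 𝟙 = refl
σ-part-and σ 𝟘 = refl
σ-part-and σ ρ = refl
σ-part-and σ σ = refl
σ-part-and σ 𝟙 = refl
σ-part-and 𝟙 y = refl

σ-part-delta : ∀ x → σ-part (delta x) ≡ true
σ-part-delta 𝟘 = refl
σ-part-delta ρ = refl
σ-part-delta σ = refl
σ-part-delta 𝟙 = refl

neg-cong : ∀ {x y} → x ∼ y → neg x ∼ neg y
neg-cong {x} {y} x∼y = trans (σ-part-neg x) (trans (cong not x∼y) (sym (σ-part-neg y)))

and-cong : ∀ {x x′ y y′} → x ∼ x′ → y ∼ y′ → and x y ∼ and x′ y′
and-cong {x} {x′} {y} {y′} x∼x′ y∼y′ =
  trans (σ-part-and x y) (trans (cong₂ _∧_ x∼x′ y∼y′) (sym (σ-part-and x′ y′)))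

or-cong : ∀ {x x′ y y′} → x ∼ x′ → y ∼ y′ → or x y ∼ or x′ y′
or-cong x∼x′ y∼y′ = neg-cong (and-cong (neg-cong x∼x′) (neg-cong y∼y′))

imp-cong : ∀ {x x′ y y′} → x ∼ x′ → y ∼ y′ → imp x y ∼ imp x′ y′
imp-cong x∼x′ y∼y′ = or-cong (neg-cong x∼x′) y∼y′

delta-cong : ∀ x y → delta x ∼ delta y
delta-cong x y = trans (σ-part-delta x) (sym (σ-part-delta y))

eval-cong : ∀ F {v w : ℕ → B2} → (∀ i → v i ∼ w i) → eval v F ∼ eval w F
eval-cong (var i) v∼w = v∼w i
eval-cong (A & B) v∼w = and-cong (eval-cong A v∼w) (eval-cong B v∼w)
eval-cong (A ∨ B) v∼w = or-cong (eval-cong A v∼w) (eval-cong B v∼w)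
eval-cong (A ⊃ B) v∼w = imp-cong (eval-cong A v∼w) (eval-cong B v∼w)
eval-cong (¬f A) v∼w = neg-cong (eval-cong A v∼w)
eval-cong (Δ A) {v} {w} _ = delta-cong (eval v A) (eval w A)

In0ρ⇒∼𝟘 : ∀ {x} → In0ρ x → x ∼ 𝟘
In0ρ⇒∼𝟘 (inj₁ refl) = refl
In0ρ⇒∼𝟘 (inj₂ refl) = refl

∼𝟘⇒In0ρ : ∀ x → x ∼ 𝟘 → In0ρ x
∼𝟘⇒In0ρ 𝟘 _ = inj₁ refl
∼𝟘⇒In0ρ ρ _ = inj₂ refl

¬In0ρ⇒σ⊎𝟙 : ∀ x → ¬ In0ρ x → (x ≡ σ) ⊎ (x ≡ 𝟙)
¬In0ρ⇒σ⊎𝟙 𝟘 x∉ = contradiction (inj₁ refl) x∉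
¬In0ρ⇒σ⊎𝟙 ρ x∉ = contradiction (inj₂ refl) x∉
¬In0ρ⇒σ⊎𝟙 σ _ = inj₁ refl
¬In0ρ⇒σ⊎𝟙 𝟙 _ = inj₂ refl

preserves-In0ρ : ∀ F → In0ρ (eval (λ _ → 𝟘) F) → Preserves F In0ρ
preserves-In0ρ F F𝟘∈ v v∈ =
  ∼𝟘⇒In0ρ (eval v F) (trans (eval-cong F (λ i → In0ρ⇒∼𝟘 (v∈ i))) (In0ρ⇒∼𝟘 F𝟘∈))

¬preserves-In0ρ : ∀ F → ¬ Preserves F In0ρ →
  (eval (λ _ → 𝟘) F ≡ σ) ⊎ (eval (λ _ → 𝟘) F ≡ 𝟙)
¬preserves-In0ρ F ¬pres = ¬In0ρ⇒σ⊎𝟙 _ (λ F𝟘∈ → ¬pres (preserves-In0ρ F F𝟘∈))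

maxVar : Formula → ℕ
maxVar (var i) = i
maxVar (A & B) = maxVar A ⊔ maxVar B
maxVar (A ∨ B) = maxVar A ⊔ maxVar B
maxVar (A ⊃ B) = maxVar A ⊔ maxVar B
maxVar (¬f A) = maxVar A
maxVar (Δ A) = maxVar A

eval-local : ∀ F {v w : ℕ → B2} → (∀ i → i ≤ maxVar F → v i ≡ w i) → eval v F ≡ eval w F
eval-local (var i) v≡w = v≡w i ≤-refl
eval-local (A & B) v≡w = cong₂ and (eval-local A (λ i i≤ → v≡w i (≤-trans i≤ (m≤m⊔n _ _))))
                                   (eval-local B (λ i i≤ → v≡w i (≤-trans i≤ (m≤n⊔m _ _))))
eval-local (A ∨ B) v≡w = cong₂ or  (eval-local A (λ i i≤ → v≡w i (≤-trans i≤ (m≤m⊔n _ _))))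
                                   (eval-local B (λ i i≤ → v≡w i (≤-trans i≤ (m≤n⊔m _ _))))
eval-local (A ⊃ B) v≡w = cong₂ imp (eval-local A (λ i i≤ → v≡w i (≤-trans i≤ (m≤m⊔n _ _))))
                                   (eval-local B (λ i i≤ → v≡w i (≤-trans i≤ (m≤n⊔m _ _))))
eval-local (¬f A) v≡w = cong neg (eval-local A v≡w)
eval-local (Δ A) v≡w = cong delta (eval-local A v≡w)

update : (ℕ → B2) → ℕ → B2 → ℕ → B2
update v x b i with i ≟ x
... | yes _ = b
... | no _  = v i

eval-subst : ∀ A x B (v : ℕ → B2) → eval v (subst A x B) ≡ eval (update v x (eval v B)) A
eval-subst (var i) x B v with i ≟ x
... | yes _ = refl
... | no _  = refl
eval-subst (A₁ & A₂) x B v = cong₂ and (eval-subst A₁ x B v) (eval-subst A₂ x B v)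
eval-subst (A₁ ∨ A₂) x B v = cong₂ or (eval-subst A₁ x B v) (eval-subst A₂ x B v)
eval-subst (A₁ ⊃ A₂) x B v = cong₂ imp (eval-subst A₁ x B v) (eval-subst A₂ x B v)
eval-subst (¬f A) x B v = cong neg (eval-subst A x B v)
eval-subst (Δ A) x B v = cong delta (eval-subst A x B v)

Equiv-of-eval : ∀ A B → (∀ v → eval v A ≡ eval v B) → Equiv A B
Equiv-of-eval A B A≡B v rewrite A≡B v = imp-self-valid (eval v B)
  where
  imp-self-valid : ∀ x → and (imp x x) (imp x x) ≡ 𝟙
  imp-self-valid 𝟘 = refl
  imp-self-valid ρ = refl
  imp-self-valid σ = refl
  imp-self-valid 𝟙 = refl

module _ (p : ℕ) where

  collapse : Formula → Formula
  collapse (var _) = var p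
  collapse (A & B) = collapse A & collapse B
  collapse (A ∨ B) = collapse A ∨ collapse B
  collapse (A ⊃ B) = collapse A ⊃ collapse B
  collapse (¬f A) = ¬f collapse A
  collapse (Δ A) = Δ collapse A

  collapse-onlyVar : ∀ A → OnlyVar p (collapse A)
  collapse-onlyVar (var _) = ov-var
  collapse-onlyVar (A & B) = ov-& (collapse-onlyVar A) (collapse-onlyVar B)
  collapse-onlyVar (A ∨ B) = ov-∨ (collapse-onlyVar A) (collapse-onlyVar B)
  collapse-onlyVar (A ⊃ B) = ov-⊃ (collapse-onlyVar A) (collapse-onlyVar B)
  collapse-onlyVar (¬f A) = ov-¬ (collapse-onlyVar A)
  collapse-onlyVar (Δ A) = ov-Δ (collapse-onlyVar A)

  eval-collapse : ∀ A v → eval v (collapse A) ≡ eval (λ _ → v p) A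
  eval-collapse (var _) v = refl
  eval-collapse (A & B) v = cong₂ and (eval-collapse A v) (eval-collapse B v)
  eval-collapse (A ∨ B) v = cong₂ or (eval-collapse A v) (eval-collapse B v)
  eval-collapse (A ⊃ B) v = cong₂ imp (eval-collapse A v) (eval-collapse B v)
  eval-collapse (¬f A) v = cong neg (eval-collapse A v)
  eval-collapse (Δ A) v = cong delta (eval-collapse A v)

  identify : ℕ → Formula → Formula
  identify zero G = G
  identify (suc n) G = identify n (subst G n (var p))

  pinned : (ℕ → B2) → ℕ → ℕ → B2
  pinned v zero = v
  pinned v (suc n) = update (pinned v n) n (pinned v n p)

  identify-expressible : ∀ {Σ} n {G} → Expressible Σ G → Expressible Σ (identify n G)
  identify-expressible zero G∈ = G∈
  identify-expressible (suc n) G∈ = identify-expressible n (ex-subst n G∈ (ex-var p))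

  eval-identify : ∀ n G v → eval v (identify n G) ≡ eval (pinned v n) G
  eval-identify zero G v = refl
  eval-identify (suc n) G v =
    trans (eval-identify n (subst G n (var p)) v) (eval-subst G n (var p) (pinned v n))

  pinned-≥ : ∀ v n i → n ≤ i → pinned v n i ≡ v i
  pinned-≥ v zero i _ = refl
  pinned-≥ v (suc n) i n<i with i ≟ n
  ... | yes refl = contradiction n<i 1+n≰n
  ... | no _ = pinned-≥ v n i (<⇒≤ n<i)

  pinned-< : ∀ v n i → n ≤ p → i < n → pinned v n i ≡ v p
  pinned-< v (suc n) i n<p (s≤s i≤n) with i ≟ n
  ... | yes _ = pinned-≥ v n p (<⇒≤ n<p)
  ... | no i≢n = pinned-< v n i (<⇒≤ n<p) (≤∧≢⇒< i≤n i≢n)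

-- p = suc (maxVar F) lies above every variable of F, so identify p p F pins all of them to p.
collapse-expressible : ∀ {Σ} F → Expressible Σ F → Expressible Σ (collapse (suc (maxVar F)) F)
collapse-expressible F F∈ = ex-equiv (identify-expressible p p F∈) (Equiv-of-eval (identify p p F) (collapse p F) same-values)
  where
  p = suc (maxVar F)
  same-values : ∀ v → eval v (identify p p F) ≡ eval v (collapse p F)
  same-values v =
    trans (eval-identify p p F v)
          (trans (eval-local F (λ i i≤ → pinned-< p v p i ≤-refl (s≤s i≤)))
                 (sym (eval-collapse p F v)))

lemma1 : (F₁ : Formula) → ¬ Preserves F₁ In0ρ →
    ∃₂ λ (p : ℕ) (A : Formula) → OnlyVar p A
    × ((eval (λ _ → 𝟘) A ≡ σ) ⊎ (eval (λ _ → 𝟘) A ≡ 𝟙))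
    × Expressible (λ G → G ≡ F₁) A
lemma1 F ¬pres =
  p , collapse p F , collapse-onlyVar p F , value-at-𝟘 , collapse-expressible F (ex-base refl)
  where
  p = suc (maxVar F)
  value-at-𝟘 : (eval (λ _ → 𝟘) (collapse p F) ≡ σ) ⊎ (eval (λ _ → 𝟘) (collapse p F) ≡ 𝟙)
  value-at-𝟘 rewrite eval-collapse p F (λ _ → 𝟘) = ¬preserves-In0ρ F ¬pres
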